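{- Let $(G,k,d)$ be an instance of \textsc{Contraction(vc)} with $k = \mathrm{rank}(G)$. Then $(G,k,d)$ is a yes-instance if and only if $d \le \mathrm{vc}(G)$.
   Context: All graphs are finite, simple and undirected. For $F \subseteq E(G)$, $G/F$ is the graph obtained by contracting all edges of $F$ (contracting $uv$ deletes $u,v$ and adds a new vertex adjacent to all former neighbours of $u$ or $v$; no loops or parallel edges). $\mathrm{vc}(G)$ is the size of a minimum vertex cover of $G$; $\mathrm{rank}(G)$ is the number of vertices of $G$ minus the number of its connected components. An instance $(G,k,d)$ of \textsc{Contraction(vc)} ($k,d$ non-negative integers) is a yes-instance iff there exists $F \subseteq E(G)$ with $|F|\le k$ and $\mathrm{vc}(G/F) \le \mathrm{vc}(G)-d$. -}

module Defs where

open import Data.Nat using (ℕ; _+_; _∸_; _≤_)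
open import Data.Bool using (Bool; T; false)
open import Data.Fin using (Fin; _<_)
open import Data.Fin.Subset using (Subset; _∈_; ∣_∣)
open import Data.List using (List; length)
open import Data.List.Relation.Unary.All using (All)
open import Data.List.Relation.Unary.Unique.Propositional using (Unique)
import Data.List.Membership.Propositional as Mem
open import Data.Product using (Σ; ∃; ∃-syntax; _×_; _,_; proj₁; proj₂)
open import Data.Sum using (_⊎_)
open import Relation.Nullary using (¬_)
open import Relation.Binary.PropositionalEquality using (_≡_; _≢_)
open import Relation.Binary.Construct.Closure.ReflexiveTransitive using (Star)
open import Function.Bundles using (_⇔_)

record Graph (n : ℕ) : Set where
  field
    adj    : Fin n → Fin n → Bool
    sym    : ∀ u v → adj u v ≡ adj v u
    irrefl : ∀ u → adj u u ≡ false

  Adj : Fin n → Fin n → Set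
  Adj u v = T (adj u v)

open Graph public

IsVertexCover : ∀ {n} → Graph n → Subset n → Set
IsVertexCover G S = ∀ u v → Adj G u v → (u ∈ S) ⊎ (v ∈ S)

IsVC : ∀ {n} → Graph n → ℕ → Set
IsVC {n} G c =
  (Σ (Subset n) λ S → IsVertexCover G S × ∣ S ∣ ≡ c)
  × (∀ (S : Subset n) → IsVertexCover G S → c ≤ ∣ S ∣)

-- An edge set F ⊆ E(G): a duplicate-free list of edges, each edge uv stored
-- once in canonical orientation u < v.  |F| = length F.
IsEdgeSet : ∀ {n} → Graph n → List (Fin n × Fin n) → Set
IsEdgeSet G F =
  All (λ e → proj₁ e < proj₂ e × Adj G (proj₁ e) (proj₂ e)) F
  × Unique F

FEdge : ∀ {n} → List (Fin n × Fin n) → Fin n → Fin n → Set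
FEdge F u v = (u , v) Mem.∈ F ⊎ (v , u) Mem.∈ F

-- H (on Fin m) together with π : Fin n → Fin m is (a copy of) G/F:
-- vertices of G/F are the connected components of (V(G), F), π sends a vertex
-- to its class, and two distinct classes are adjacent iff some edge of G joins them.
IsContraction : ∀ {n m} → Graph n → List (Fin n × Fin n) → Graph m → (Fin n → Fin m) → Set
IsContraction {n} {m} G F H π =
  (∀ (a : Fin m) → ∃[ u ] π u ≡ a)
  × (∀ u v → (π u ≡ π v) ⇔ Star (FEdge F) u v)
  × (∀ a b → Adj H a b ⇔ (a ≢ b × ∃[ u ] ∃[ v ] (π u ≡ a × π v ≡ b × Adj G u v)))

GEdge : ∀ {n} → Graph n → Fin n → Fin n → Set
GEdge G u v = Adj G u v

HasComponents : ∀ {n} → Graph n → ℕ → Set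
HasComponents {n} G m =
  Σ (Fin n → Fin m) λ π →
    (∀ (a : Fin m) → ∃[ u ] π u ≡ a)
    × (∀ u v → (π u ≡ π v) ⇔ Star (GEdge G) u v)

IsRank : ∀ {n} → Graph n → ℕ → Set
IsRank {n} G r = ∃[ m ] (HasComponents G m × r ≡ n ∸ m)

-- (G,k,d) is a yes-instance of Contraction(vc), where c = vc(G):
-- some F ⊆ E(G) with |F| ≤ k has vc(G/F) + d ≤ c  (i.e. vc(G/F) ≤ vc(G) - d).
YesInstance : ∀ {n} → Graph n → ℕ → ℕ → Set
YesInstance {n} G k d =
  ∃[ F ] (IsEdgeSet G F × length F ≤ k ×
    ∃[ m ] Σ (Graph m) λ H → Σ (Fin n → Fin m) λ π →
      IsContraction G F H π × ∃[ c' ] ∃[ c ] (IsVC H c' × IsVC G c × c' + d ≤ c))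

-- Contracting the k = rank(G) edges of a spanning forest F shrinks every
-- connected component of G to a single vertex, so G/F is edgeless and
-- vc(G/F) = 0 ≤ vc(G) − d whenever d ≤ vc(G).  Conversely vc(G/F) ≥ 0 forces
-- d ≤ vc(G).  A spanning forest with |F| ≤ rank(G) is built Kruskal-style with
-- a union-find labelling: every accepted edge merges two classes, so
-- |F| + #classes ≤ n, and the final classes are the components of G.
module Submission where

open import Defs
open import Data.Nat using (ℕ; _≤_)
open import Function.Bundles using (_⇔_)

open import Data.Nat using (_+_; _∸_; z≤n)
open import Data.Nat.Properties
  using (≤-trans; ≤-<-trans; ≤-antisym; m≤n+m; +-monoʳ-≤; +-monoʳ-<; m+n≤o⇒m≤o∸n)
open import Data.Bool using (T; false)
open import Data.Bool.Properties using (T?)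
open import Data.Fin using (Fin; zero; suc; _<_; _<?_)
open import Data.Fin.Properties using (_≟_; injective⇒≤; suc-injective; <-cmp)
open import Data.Fin.Subset using (Subset; inside; outside; ⊥; ∣_∣; _-_)
  renaming (_∈_ to _∈ₛ_)
open import Data.Fin.Subset.Properties
  using (∣⊥∣≡0; ∣p∣≤n; p⊆q⇒∣p∣≤∣q∣; x∈p∧x≢y⇒x∈p-y; x∈p⇒∣p-x∣<∣p∣)
open import Data.Vec using (_∷_; here; there; tabulate)
open import Data.Vec.Properties using (lookup∘tabulate; []=⇒lookup; lookup⇒[]=)
open import Data.List using (List; []; _∷_; length; allFin; cartesianProduct; filter)
open import Data.List.Relation.Unary.All using (All; []; _∷_; lookup)
open import Data.List.Relation.Unary.All.Properties using (¬Any⇒All¬; all-filter)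
open import Data.List.Relation.Unary.Any using (here; there)
open import Data.List.Relation.Unary.AllPairs using ([]; _∷_)
open import Data.List.Membership.Propositional using (_∉_)
open import Data.List.Membership.Propositional.Properties
  using (∈-allFin; ∈-cartesianProduct⁺; ∈-filter⁺)
open import Data.Product using (∃-syntax; _×_; _,_; proj₁; proj₂)
open import Data.Sum using (inj₁; inj₂)
open import Function using (_∘_)
open import Function.Bundles using (mk⇔; Equivalence)
open import Function.Definitions using (Injective)
open import Relation.Binary.Core using (_⇒_)
open import Relation.Binary.Definitions using (tri<; tri≈; tri>)
open import Relation.Binary.PropositionalEquality
  using (_≡_; _≢_; refl; trans; cong; subst) renaming (sym to ≡-sym)
open import Relation.Binary.Construct.Closure.ReflexiveTransitive as Star
  using (Star; ε; _◅_; _◅◅_; _⋆)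
open import Relation.Nullary using (Dec; yes; no; does; contradiction)
open import Relation.Unary using (Decidable)
open import Relation.Nullary.Decidable using (dec-true; _×-dec_)
open Equivalence using (to; from)

position : ∀ {n} {p : Subset n} {x} → x ∈ₛ p → Fin ∣ p ∣
position {p = inside ∷ p} here = zero
position {p = inside ∷ p} (there x∈p) = suc (position x∈p)
position {p = outside ∷ p} (there x∈p) = position x∈p

position-injective : ∀ {n} {p : Subset n} {x y} (x∈p : x ∈ₛ p) (y∈p : y ∈ₛ p) →
                     position x∈p ≡ position y∈p → x ≡ y
position-injective {p = inside ∷ p} here here eq = refl
position-injective {p = inside ∷ p} here (there y∈p) ()
position-injective {p = inside ∷ p} (there x∈p) here ()
position-injective {p = inside ∷ p} (there x∈p) (there y∈p) eq =
  cong suc (position-injective x∈p y∈p (suc-injective eq))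
position-injective {p = outside ∷ p} (there x∈p) (there y∈p) eq =
  cong suc (position-injective x∈p y∈p eq)

injective⇒≤∣p∣ : ∀ {m n} {p : Subset n} (f : Fin m → Fin n) →
                 (∀ a → f a ∈ₛ p) → Injective _≡_ _≡_ f → m ≤ ∣ p ∣
injective⇒≤∣p∣ f f∈p f-inj = injective⇒≤ (f-inj ∘ position-injective (f∈p _) (f∈p _))

Roots : ∀ {n} → (Fin n → Fin n) → Subset n
Roots ρ = tabulate λ w → does (ρ w ≟ w)

root∈Roots : ∀ {n} (ρ : Fin n → Fin n) {w} → ρ w ≡ w → w ∈ₛ Roots ρ
root∈Roots ρ {w} ρw≡w =
  lookup⇒[]= w _ (trans (lookup∘tabulate _ w) (dec-true (ρ w ≟ w) ρw≡w))

∈Roots⇒root : ∀ {n} (ρ : Fin n → Fin n) {w} → w ∈ₛ Roots ρ → ρ w ≡ w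
∈Roots⇒root ρ {w} w∈R with ρ w ≟ w | trans (≡-sym (lookup∘tabulate _ w)) ([]=⇒lookup w∈R)
... | yes ρw≡w | _ = ρw≡w
... | no _ | ()

IsOrientedEdge : ∀ {n} → Graph n → Fin n × Fin n → Set
IsOrientedEdge G e = proj₁ e < proj₂ e × Adj G (proj₁ e) (proj₂ e)

FEdge-sym : ∀ {n} {F : List (Fin n × Fin n)} {x y} → FEdge F x y → FEdge F y x
FEdge-sym (inj₁ p) = inj₂ p
FEdge-sym (inj₂ p) = inj₁ p

FEdge-∷ : ∀ {n} {F : List (Fin n × Fin n)} {e} → FEdge F ⇒ FEdge (e ∷ F)
FEdge-∷ (inj₁ p) = inj₁ (there p)
FEdge-∷ (inj₂ p) = inj₂ (there p)

module _ {n} (G : Graph n) where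

  -- root w is the representative of the F-component of w; size says F is
  -- acyclic, since a forest has n − #components edges.
  record Forest (F : List (Fin n × Fin n)) : Set where
    field
      edgeSet   : IsEdgeSet G F
      root      : Fin n → Fin n
      root-idem : ∀ w → root (root w) ≡ root w
      classes   : ∀ u v → (root u ≡ root v) ⇔ Star (FEdge F) u v
      size      : length F + ∣ Roots root ∣ ≤ n

  open Forest

  emptyForest : Forest []
  emptyForest = record
    { edgeSet   = [] , []
    ; root      = λ w → w
    ; root-idem = λ _ → refl
    ; classes   = λ u v → mk⇔ (λ { refl → ε }) (λ { ε → refl ; (inj₁ () ◅ _) ; (inj₂ () ◅ _) })
    ; size      = ∣p∣≤n (Roots (λ w → w))
    }

  module Merge {F} (φ : Forest F) {u v} (uv : IsOrientedEdge G (u , v))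
               (apart : root φ u ≢ root φ v) where

    redirect : ∀ {y} → Dec (y ≡ root φ v) → Fin n
    redirect {y} (yes _) = root φ u
    redirect {y} (no _)  = y

    merge : Fin n → Fin n
    merge y = redirect (y ≟ root φ v)

    data MergeCases (y : Fin n) : Set where
      moved : y ≡ root φ v → merge y ≡ root φ u → MergeCases y
      kept  : y ≢ root φ v → merge y ≡ y → MergeCases y

    merge-cases : ∀ y → MergeCases y
    merge-cases y = cases (y ≟ root φ v) refl
      where
      cases : (d : Dec (y ≡ root φ v)) → merge y ≡ redirect d → MergeCases y
      cases (yes eq) m≡ = moved eq m≡
      cases (no neq) m≡ = kept neq m≡

    merge-root-u : merge (root φ u) ≡ root φ u
    merge-root-u with merge-cases (root φ u)
    ... | moved eq _  = contradiction eq apart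
    ... | kept _ fix = fix

    root′ : Fin n → Fin n
    root′ = merge ∘ root φ

    root′-idem : ∀ w → root′ (root′ w) ≡ root′ w
    root′-idem w with merge-cases (root φ w)
    ... | moved _ eq rewrite eq | root-idem φ u = merge-root-u
    ... | kept _ eq rewrite eq | root-idem φ w = eq

    F′ : List (Fin n × Fin n)
    F′ = (u , v) ∷ F

    lift : Star (FEdge F) ⇒ Star (FEdge F′)
    lift = Star.map FEdge-∷

    new : Star (FEdge F′) v u
    new = inj₂ (here refl) ◅ ε

    edgeSet′ : IsEdgeSet G F′
    edgeSet′ = (uv ∷ proj₁ (edgeSet φ)) , (¬Any⇒All¬ F uv∉F ∷ proj₂ (edgeSet φ))
      where
      uv∉F : (u , v) ∉ F
      uv∉F uv∈F = apart (from (classes φ u v) (inj₁ uv∈F ◅ ε))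

    merge-root-v : merge (root φ v) ≡ root φ u
    merge-root-v with merge-cases (root φ v)
    ... | moved _ eq = eq
    ... | kept neq _ = contradiction refl neq

    unmoved : ∀ x → root′ x ≢ root φ u → root φ x ≡ root′ x
    unmoved x x↛u with merge-cases (root φ x)
    ... | moved _ eq = contradiction eq x↛u
    ... | kept _ eq  = ≡-sym eq

    respects : ∀ {x y} → FEdge F′ x y → root′ x ≡ root′ y
    respects (inj₁ (here refl))  = trans merge-root-u (≡-sym merge-root-v)
    respects (inj₂ (here refl))  = trans merge-root-v (≡-sym merge-root-u)
    respects (inj₁ (there uv∈F)) = cong merge (from (classes φ _ _) (inj₁ uv∈F ◅ ε))
    respects (inj₂ (there vu∈F)) = cong merge (from (classes φ _ _) (inj₂ vu∈F ◅ ε))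

    joined-to-u : ∀ x → root′ x ≡ root φ u → Star (FEdge F′) x u
    joined-to-u x x↦u with merge-cases (root φ x)
    ... | moved x~v _ = lift (to (classes φ x v) x~v) ◅◅ new
    ... | kept _ eq   = lift (to (classes φ x u) (trans (≡-sym eq) x↦u))

    classes′ : ∀ x y → (root′ x ≡ root′ y) ⇔ Star (FEdge F′) x y
    classes′ x y = mk⇔ joined (Star.fold (λ a b → root′ a ≡ root′ b) (λ s → trans (respects s)) refl)
      where
      joined : root′ x ≡ root′ y → Star (FEdge F′) x y
      joined eq with root′ x ≟ root φ u
      ... | yes x↦u = joined-to-u x x↦u ◅◅ Star.reverse FEdge-sym (joined-to-u y (trans (≡-sym eq) x↦u))
      ... | no x↛u  = lift (to (classes φ x y)
                        (trans (unmoved x x↛u) (trans eq (≡-sym (unmoved y (x↛u ∘ trans eq))))))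

    Roots′⊆Roots-v : ∀ {w} → w ∈ₛ Roots root′ → w ∈ₛ Roots (root φ) - root φ v
    Roots′⊆Roots-v {w} w∈R′ with merge-cases (root φ w)
    ... | moved w~v eq = contradiction (trans (≡-sym (trans (cong (root φ) w≡u) (root-idem φ u))) w~v) apart
      where
      w≡u : w ≡ root φ u
      w≡u = trans (≡-sym (∈Roots⇒root root′ w∈R′)) eq
    ... | kept w≁v eq  = x∈p∧x≢y⇒x∈p-y (root∈Roots (root φ) rw≡w) (w≁v ∘ trans rw≡w)
      where
      rw≡w : root φ w ≡ w
      rw≡w = trans (≡-sym eq) (∈Roots⇒root root′ w∈R′)

    size′ : length F′ + ∣ Roots root′ ∣ ≤ n
    size′ = ≤-trans (+-monoʳ-< (length F) (≤-<-trans (p⊆q⇒∣p∣≤∣q∣ Roots′⊆Roots-v)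
                                            (x∈p⇒∣p-x∣<∣p∣ (root∈Roots (root φ) (root-idem φ v)))))
                    (size φ)

    forest′ : Forest F′
    forest′ = record
      { edgeSet = edgeSet′ ; root = root′ ; root-idem = root′-idem ; classes = classes′ ; size = size′ }

  insertEdge : ∀ {F} → Forest F → ∀ {u v} → IsOrientedEdge G (u , v) →
               ∃[ F′ ] Forest F′ × (Star (FEdge F) ⇒ Star (FEdge F′)) × Star (FEdge F′) u v
  insertEdge {F} φ {u} {v} uv with root φ u ≟ root φ v
  ... | yes joined = F , φ , (λ p → p) , to (classes φ u v) joined
  ... | no apart   = F′ , forest′ , lift , Star.reverse FEdge-sym new
    where open Merge φ uv apart

  Joins : List (Fin n × Fin n) → Fin n × Fin n → Set
  Joins F e = Star (FEdge F) (proj₁ e) (proj₂ e)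

  extendForest : ∀ {F} → Forest F → (es : List (Fin n × Fin n)) → All (IsOrientedEdge G) es →
                 ∃[ F′ ] Forest F′ × (Star (FEdge F) ⇒ Star (FEdge F′)) × All (Joins F′) es
  extendForest φ [] [] = _ , φ , (λ p → p) , []
  extendForest φ (e ∷ es) (oe ∷ oes) with insertEdge φ oe
  ... | F₁ , φ₁ , mono₁ , joins₁ with extendForest φ₁ es oes
  ... | F₂ , φ₂ , mono₂ , joins₂ = F₂ , φ₂ , mono₂ ∘ mono₁ , mono₂ joins₁ ∷ joins₂

  forest⊆graph : ∀ {F} → Forest F → FEdge F ⇒ GEdge G
  forest⊆graph φ (inj₁ uv∈F) = proj₂ (lookup (proj₁ (edgeSet φ)) uv∈F)
  forest⊆graph φ {u} {v} (inj₂ vu∈F) = subst T (sym G v u) (proj₂ (lookup (proj₁ (edgeSet φ)) vu∈F))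

  isOrientedEdge? : Decidable (IsOrientedEdge G)
  isOrientedEdge? e = (proj₁ e <? proj₂ e) ×-dec T? (adj G (proj₁ e) (proj₂ e))

  allPairs : List (Fin n × Fin n)
  allPairs = cartesianProduct (allFin n) (allFin n)

  spanningForest : ∃[ F ] Forest F × (∀ u v → Star (FEdge F) u v ⇔ Star (GEdge G) u v)
  spanningForest
    with extendForest emptyForest (filter isOrientedEdge? allPairs) (all-filter isOrientedEdge? allPairs)
  ... | F , φ , _ , joins = F , φ , λ u v → mk⇔ (Star.map (forest⊆graph φ)) (spans ⋆)
    where
    joins-oriented : ∀ {u v} → u < v → GEdge G u v → Star (FEdge F) u v
    joins-oriented {u} {v} u<v uv =
      lookup joins (∈-filter⁺ isOrientedEdge? (∈-cartesianProduct⁺ (∈-allFin u) (∈-allFin v)) (u<v , uv))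

    spans : GEdge G ⇒ Star (FEdge F)
    spans {u} {v} uv with <-cmp u v
    ... | tri< u<v _ _  = joins-oriented u<v uv
    ... | tri≈ _ refl _ = ε
    ... | tri> _ _ v<u  = Star.reverse FEdge-sym (joins-oriented v<u (subst T (sym G u v) uv))

  forest-size : ∀ {F m} → Forest F → HasComponents G m → length F + m ≤ n
  forest-size {F} {m} φ (π , surjective , components) =
    ≤-trans (+-monoʳ-≤ (length F) m≤∣Roots∣) (size φ)
    where
    representative : ∀ a → Fin n
    representative a = proj₁ (surjective a)

    -- F-paths are G-paths, so distinct components have distinct F-roots.
    root-injective : Injective _≡_ _≡_ (root φ ∘ representative)
    root-injective {a} {b} eq = trans (≡-sym (proj₂ (surjective a)))
      (trans (from (components _ _) (Star.map (forest⊆graph φ) (to (classes φ _ _) eq)))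
             (proj₂ (surjective b)))

    m≤∣Roots∣ : m ≤ ∣ Roots (root φ) ∣
    m≤∣Roots∣ = injective⇒≤∣p∣ (root φ ∘ representative)
                  (λ a → root∈Roots (root φ) (root-idem φ (representative a))) root-injective

vc-unique : ∀ {n} {G : Graph n} {c c′} → IsVC G c → IsVC G c′ → c ≡ c′
vc-unique ((S , S-covers , refl) , S-minimum) ((S′ , S′-covers , refl) , S′-minimum) =
  ≤-antisym (S-minimum S′ S′-covers) (S′-minimum S S-covers)

edgeless : (m : ℕ) → Graph m
edgeless m = record { adj = λ _ _ → false ; sym = λ _ _ → refl ; irrefl = λ _ → refl }

edgeless-vc : ∀ m → IsVC (edgeless m) 0
edgeless-vc m = (⊥ , (λ _ _ ()) , ∣⊥∣≡0 m) , λ _ _ → z≤n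

contract-components : ∀ {n m} {G : Graph n} {F} → ((π , _) : HasComponents G m) →
                      (∀ u v → Star (FEdge F) u v ⇔ Star (GEdge G) u v) →
                      IsContraction G F (edgeless m) π
contract-components {G = G} {F} (π , surjective , components) spanning =
  surjective , classes , λ a b → mk⇔ (λ ()) no-edge
  where
  classes : ∀ u v → (π u ≡ π v) ⇔ Star (FEdge F) u v
  classes u v = mk⇔ (from (spanning u v) ∘ to (components u v)) (from (components u v) ∘ to (spanning u v))

  no-edge : ∀ {a b} → a ≢ b × ∃[ u ] ∃[ v ] (π u ≡ a × π v ≡ b × Adj G u v) → T false
  no-edge (a≢b , u , v , refl , refl , uv) = a≢b (from (components u v) (_◅_ {j = v} uv ε))

mainTheorem5 : ∀ {n} (G : Graph n) (k d c : ℕ) →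
    IsRank G k → IsVC G c → (YesInstance G k d ⇔ d ≤ c)
mainTheorem5 {n} G k d c (m , comp , refl) vc = mk⇔ necessary sufficient
  where
  necessary : YesInstance G (n ∸ m) d → d ≤ c
  necessary (_ , _ , _ , _ , _ , _ , _ , c′ , c₀ , _ , vc₀ , c′+d≤c₀) =
    ≤-trans (m≤n+m d c′) (subst (c′ + d ≤_) (vc-unique {G = G} vc₀ vc) c′+d≤c₀)

  sufficient : d ≤ c → YesInstance G (n ∸ m) d
  sufficient d≤c with spanningForest G
  ... | F , φ , spanning =
    F , Forest.edgeSet φ , m+n≤o⇒m≤o∸n (length F) (forest-size G φ comp) ,
    m , edgeless m , proj₁ comp , contract-components {G = G} {F = F} comp spanning ,
    0 , c , edgeless-vc m , vc , d≤c
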